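{- Let $G$ be an embedded graph and $e$ any edge of $G$. Then \[ P(G;\lambda)=P(G^{\delta(e)};\lambda)-P(G^{\delta\tau(e)};\lambda)=P(G^{\delta(e)};\lambda)+P(G^{\delta\tau\delta(e)};\lambda). \]
   Context: An embedded graph is a graph cellularly embedded in a closed (possibly non-orientable) surface, up to homeomorphism; equivalently a ribbon graph. It may be encoded by an arrow presentation: one circle per vertex carrying disjoint arrows, each edge label appearing on exactly two arrows (the two attaching arcs of that edge, oriented consistently with an orientation of the edge disc); presentations are equivalent up to reversing both arrows of a label and relabelling. For an edge $e$: $G^{\tau(e)}$ (half-twist / partial Petrial) is obtained by reversing exactly one of the two arrows labelled $e$. $G^{\delta(e)}$ (partial dual) is obtained as follows: if $A,B$ are the two arrows labelled $e$, draw a segment with an arrow from the head of $A$ to the tail of $B$ and a segment with an arrow from the head of $B$ to the tail of $A$, label both $e$, and delete $A$ and $B$ together with the arcs containing them, so the new segments become arcs of the new circles. Composite operations act right-to-left: $G^{\delta\tau(e)}:=(G^{\tau(e)})^{\delta(e)}$ and $G^{\delta\tau\delta(e)}:=((G^{\delta(e)})^{\tau(e)})^{\delta(e)}$. Penrose polynomial: the medial graph $G_m$ has a degree-4 vertex $v_e$ on each edge $e$ of $G$, with edges following the face boundaries of $G$ (an isolated vertex of $G$ contributes a vertex-free closed curve); its canonical checkerboard colouring colours a face black if it contains a vertex of $G$, white otherwise. At $v_e$, the white split pairs consecutive half-edges bounding white corners, the black split pairs those bounding black corners, and the crossing pairs opposite half-edges. A state $s$ chooses a vertex state at each vertex; $c(s)$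 = number of resulting closed curves, $cr(s)$ = number of crossings. Penrose states are states with no black split, and $P(G;\lambda)=\sum_{s\text{ Penrose}}(-1)^{cr(s)}\lambda^{c(s)}$. -}

module Defs where

open import Data.Nat using (ℕ; zero; suc; _+_; _*_; _≤ᵇ_; _≡ᵇ_)
open import Data.Fin using (Fin; zero; suc; toℕ; _≟_)
open import Data.Bool using (Bool; true; false; if_then_else_; _∧_)
open import Data.Product using (_×_; _,_; proj₁; proj₂)
open import Data.List using (List; []; _∷_; map; concatMap; allFin; foldr; upTo)
open import Data.Vec using (Vec; []; _∷_; lookup)
open import Data.Integer using (ℤ; +_; -_) renaming (_+_ to _+ℤ_)
open import Relation.Nullary using (yes; no; ¬_)
open import Relation.Nullary.Decidable using (⌊_⌋)
open import Relation.Binary.PropositionalEquality using (_≡_)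

-- Edge e of an embedded graph with m edges has two arrows A_e, B_e.
-- Their four endpoints ("corners" of the edge disc) are the points
--   (e , 0) = tail of A,  (e , 1) = head of A,
--   (e , 2) = tail of B,  (e , 3) = head of B,
-- listed in the cyclic order in which they occur around the boundary of
-- the (consistently oriented) edge disc.  The arrow A occupies the
-- boundary segment 0–1, the arrow B the segment 2–3.
--
-- The vertex circles are described by the "gap" involution γ: walking
-- along a vertex circle, one leaves an arrow at one of its endpoints p,
-- follows an arrow-free arc, and arrives at the endpoint γ p of the next
-- arrow.  Circles carrying arrows are the closed alternating walks
-- (arrow, gap, arrow, gap, ...); in addition there are `iso` circles
-- carrying no arrow (isolated vertices).

Point : ℕ → Set
Point m = Fin m × Fin 4

record EGraph (m : ℕ) : Set where
  field
    iso : ℕ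
    γ   : Point m → Point m
open EGraph public

record Valid {m : ℕ} (G : EGraph m) : Set where
  field
    γ-invol : ∀ p → γ G (γ G p) ≡ p
    γ-fpf   : ∀ p → ¬ (γ G p ≡ p)

atEdge : {m : ℕ} → Fin m → (Fin 4 → Fin 4) → Point m → Point m
atEdge e f (e' , c) with e' ≟ e
... | yes _ = (e' , f c)
... | no  _ = (e' , c)

swapA : Fin 4 → Fin 4
swapA zero = suc zero
swapA (suc zero) = zero
swapA c = c

rot : Fin 4 → Fin 4
rot zero = suc zero
rot (suc zero) = suc (suc zero)
rot (suc (suc zero)) = suc (suc (suc zero))
rot (suc (suc (suc zero))) = zero

rot⁻¹ : Fin 4 → Fin 4
rot⁻¹ zero = suc (suc (suc zero))
rot⁻¹ (suc zero) = zero
rot⁻¹ (suc (suc zero)) = suc zero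
rot⁻¹ (suc (suc (suc zero))) = suc (suc zero)

-- Partial Petrial G^{τ(e)}: reverse the arrow A_e (exchange its tail and
-- head), i.e. conjugate γ by the swap of corners 0,1 of e.
τ : {m : ℕ} → EGraph m → Fin m → EGraph m
τ G e = record
  { iso = iso G
  ; γ   = λ p → atEdge e swapA (γ G (atEdge e swapA p)) }

-- Partial dual G^{δ(e)}: the new arrow A' runs from head A (old corner 1)
-- to tail B (old corner 2), the new arrow B' from head B (old corner 3)
-- to tail A (old corner 0); the arcs of the circles (gaps) are kept.
-- New corner c of e is old corner rot c, so γ is conjugated by rot.
δ : {m : ℕ} → EGraph m → Fin m → EGraph m
δ G e = record
  { iso = iso G
  ; γ   = λ p → atEdge e rot⁻¹ (γ G (atEdge e rot p)) }

-- The medial vertex v_e sits in the middle of the edge disc of e; its four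
-- half-edges go to the corners 0,1,2,3 (in cyclic order), and the medial
-- edges are the gaps p — γ p.  The corners between half-edges 0,1 and
-- 2,3 lie in vertex discs (black), those between 1,2 and 3,0 lie on
-- faces (white).  Hence
--   black split : {0,1},{2,3}
--   white split : {1,2},{3,0}
--   crossing    : {0,2},{1,3}.

data VState : Set where
  white cross : VState

whiteSplit : Fin 4 → Fin 4
whiteSplit zero = suc (suc (suc zero))
whiteSplit (suc zero) = suc (suc zero)
whiteSplit (suc (suc zero)) = suc zero
whiteSplit (suc (suc (suc zero))) = zero

crossing : Fin 4 → Fin 4
crossing zero = suc (suc zero)
crossing (suc zero) = suc (suc (suc zero))
crossing (suc (suc zero)) = zero
crossing (suc (suc (suc zero))) = suc zero

PState : ℕ → Set
PState m = Vec VState m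

allPStates : (m : ℕ) → List (PState m)
allPStates zero = [] ∷ []
allPStates (suc m) =
  concatMap (λ s → (white ∷ s) ∷ (cross ∷ s) ∷ []) (allPStates m)

β : {m : ℕ} → PState m → Point m → Point m
β s (e , c) with lookup s e
... | white = (e , whiteSplit c)
... | cross = (e , crossing c)

allPoints : (m : ℕ) → List (Point m)
allPoints m = concatMap (λ e → map (λ c → (e , c)) (allFin 4)) (allFin m)

allᵇ : {A : Set} → (A → Bool) → List A → Bool
allᵇ f [] = true
allᵇ f (x ∷ xs) = f x ∧ allᵇ f xs

countᵇ : {A : Set} → (A → Bool) → List A → ℕ
countᵇ f [] = 0
countᵇ f (x ∷ xs) = if f x then suc (countᵇ f xs) else countᵇ f xs

rank : {m : ℕ} → Point m → ℕ
rank (e , c) = 4 * toℕ e + toℕ c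

walk : {m : ℕ} → EGraph m → PState m → Point m → ℕ → Point m
walk G s p zero = p
walk G s p (suc zero) = γ G p
walk G s p (suc (suc j)) = β s (γ G (walk G s p j))

-- p is the least point (w.r.t. rank) on its closed curve; every curve has
-- at most 4m points, so 4m steps of the walk visit all of it
isRep : {m : ℕ} → EGraph m → PState m → Point m → Bool
isRep {m} G s p = allᵇ (λ j → rank p ≤ᵇ rank (walk G s p j)) (upTo (4 * m))

-- c(s): number of closed curves (curves through medial vertices, plus one
-- vertex-free curve for every isolated vertex of G)
curves : {m : ℕ} → EGraph m → PState m → ℕ
curves {m} G s = iso G + countᵇ (isRep G s) (allPoints m)

crossings : {m : ℕ} → PState m → ℕ
crossings [] = 0
crossings (white ∷ s) = crossings s
crossings (cross ∷ s) = suc (crossings s)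

sign : ℕ → ℤ
sign zero = + 1
sign (suc k) = - sign k

-- Penrose polynomial P(G;λ) = Σ_{s Penrose} (-1)^{cr(s)} λ^{c(s)},
-- represented by its coefficient sequence: penrose G n is the
-- coefficient of λ^n.
penrose : {m : ℕ} → EGraph m → ℕ → ℤ
penrose {m} G n =
  foldr _+ℤ_ (+ 0)
    (map (λ s → if curves G s ≡ᵇ n then sign (crossings s) else + 0)
         (allPStates m))

-- Both δ(e) and τ(e) act on an arrow presentation by relabelling the four
-- corners of the edge e, i.e. by conjugating the gap involution γ on them.  A
-- state of a relabelled graph therefore has the same closed curves as the state
-- of G whose vertex state at e is conjugated back: for G^δ(e) white ↦ black and
-- crossing ↦ crossing, for G^δτ(e) white ↦ black and crossing ↦ white, for
-- G^δτδ(e) white ↦ white and crossing ↦ black.  Fixing the vertex states away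
-- from e and writing W, X, B for the contributions of a white split, a crossing
-- and a black split at e, the four polynomials receive W − X, B − X, B − W and
-- W − B, whence both identities.
--
-- Curves are counted by their corner of least rank.  Swapping two consecutive
-- ranks does not change that count: if the two corners lie on one curve its
-- least corner is merely relabelled, otherwise the order of ranks along every
-- curve is unchanged.  The relabelling of the corners of e is a product of such
-- swaps.

module Submission where

open import Data.Bool using (Bool; true; false; if_then_else_; T; _∧_)
open import Data.Bool.Properties using (T-∧)
open import Data.Empty using (⊥-elim)
open import Data.Fin as F using (Fin; toℕ; _≟_; combine; splitAt; join)
open import Data.Fin.Patterns using (0F; 1F; 2F; 3F)
import Data.Fin.Permutation as Perm
open import Data.Fin.Permutation
  using (Permutation′; permutation; _⟨$⟩ʳ_; _⟨$⟩ˡ_; _∘ₚ_; transpose; inverseˡ; inverseʳ)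
import Data.Fin.Permutation.Components as PC
open import Data.Fin.Properties
  using (combine-injective; toℕ-combine; pigeonhole; toℕ-injective; toℕ≤pred[n]; join-splitAt; <⇒≢)
open import Data.Integer using (ℤ; 0ℤ; 1ℤ; -_) renaming (_+_ to _+ℤ_; _-_ to _-ℤ_; _*_ to _*ℤ_)
import Data.Integer.Properties as ℤ
open import Data.Integer.Tactic.RingSolver using () renaming (solve-∀ to ℤ-solve-∀)
open import Data.List using (List; []; _∷_; _++_; map; concatMap; tabulate; applyUpTo; upTo; foldr)
open import Data.List.Properties using (map-tabulate)
open import Data.Nat
  using (ℕ; zero; suc; pred; _+_; _*_; _∸_; _≤_; _<_; _≤ᵇ_; _≡ᵇ_; z<s; s<s; s≤s; NonZero; >-nonZero)
open import Data.Nat.DivMod using (_%_; _/_; m%n<n; m≡m%n+[m/n]*n)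
open import Data.Nat.Properties
  using ( +-0-commutativeMonoid; +-assoc; +-suc; +-comm; *-comm; suc-pred; ≤-total; anyUpTo?
        ; ≤ᵇ⇒≤; ≤⇒≤ᵇ; m∸n+n≡m; m<n⇒0<n∸m; ≤-trans; m∸n≤m; m+[n∸m]≡n; <⇒≤; <-cmp; +-monoʳ-≤
        ; ≤-refl; ≤∧≢⇒<; ≤-pred; m≤n⇒m≤1+n; +-mono-≤; n≤1+n; n<1+n; <-trans; module ≤-Reasoning)
open import Data.Nat.Tactic.RingSolver using (solve-∀)
open import Data.Product using (_×_; _,_; proj₁; proj₂; ∃-syntax)
open import Data.Product.Properties using (≡-dec)
open import Data.Sum using (_⊎_; inj₁; inj₂)
open import Data.Vec using (Vec; _∷_; lookup; _[_]≔_) renaming (map to mapᵛ)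
open import Data.Vec.Properties using (lookup-map; lookup∘update; lookup∘update′; map-[]≔; []≔-idempotent)
open import Function using (_∘_; id; case_of_)
open import Function.Bundles using (_⇔_; Equivalence; mk⇔)
open import Function.Construct.Composition using (_⇔-∘_)
open import Function.Construct.Symmetry using (⇔-sym)
open import Relation.Binary.Definitions using (tri<; tri≈; tri>)
open import Relation.Binary.PropositionalEquality
open import Relation.Nullary using (Dec; yes; no; ¬_; contradiction)
open import Relation.Nullary.Decidable using (map′; dec-true; dec-false)
open import Algebra.Properties.CommutativeMonoid.Sum +-0-commutativeMonoid
  using (sum; sum-cong-≗; sum-permute)
open import Algebra.Properties.CommutativeSemigroup ℤ.+-commutativeSemigroup
  using () renaming (interchange to ℤ+-interchange)

open import Defs

private variable A B : Set

bit : Bool → ℕ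
bit true  = 1
bit false = 0

countᵇ-∷ : ∀ (P : A → Bool) x xs → countᵇ P (x ∷ xs) ≡ bit (P x) + countᵇ P xs
countᵇ-∷ P x xs with P x
... | true  = refl
... | false = refl

countᵇ-++ : ∀ (P : A → Bool) xs ys → countᵇ P (xs ++ ys) ≡ countᵇ P xs + countᵇ P ys
countᵇ-++ P []       ys = refl
countᵇ-++ P (x ∷ xs) ys = begin
  countᵇ P (x ∷ xs ++ ys)                 ≡⟨ countᵇ-∷ P x (xs ++ ys) ⟩
  bit (P x) + countᵇ P (xs ++ ys)         ≡⟨ cong (bit (P x) +_) (countᵇ-++ P xs ys) ⟩
  bit (P x) + (countᵇ P xs + countᵇ P ys) ≡⟨ +-assoc (bit (P x)) _ _ ⟨
  bit (P x) + countᵇ P xs + countᵇ P ys   ≡⟨ cong (_+ countᵇ P ys) (countᵇ-∷ P x xs) ⟨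
  countᵇ P (x ∷ xs) + countᵇ P ys         ∎
  where open ≡-Reasoning

countᵇ-cong : ∀ {P Q : A → Bool} → P ≗ Q → ∀ xs → countᵇ P xs ≡ countᵇ Q xs
countᵇ-cong P≗Q []       = refl
countᵇ-cong {P = P} {Q} P≗Q (x ∷ xs) = begin
  countᵇ P (x ∷ xs)          ≡⟨ countᵇ-∷ P x xs ⟩
  bit (P x) + countᵇ P xs    ≡⟨ cong₂ _+_ (cong bit (P≗Q x)) (countᵇ-cong P≗Q xs) ⟩
  bit (Q x) + countᵇ Q xs    ≡⟨ countᵇ-∷ Q x xs ⟨
  countᵇ Q (x ∷ xs)          ∎
  where open ≡-Reasoning

countᵇ-tabulate : ∀ (P : A → Bool) {n} (f : Fin n → A) → countᵇ P (tabulate f) ≡ sum (λ i → bit (P (f i)))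
countᵇ-tabulate P {zero}  f = refl
countᵇ-tabulate P {suc n} f =
  trans (countᵇ-∷ P (f 0F) (tabulate (f ∘ F.suc))) (cong (bit (P (f 0F)) +_) (countᵇ-tabulate P (f ∘ F.suc)))

countᵇ-concatMap : ∀ (P : A → Bool) (h : B → List A) {n} (f : Fin n → B) →
  countᵇ P (concatMap h (tabulate f)) ≡ sum (λ i → countᵇ P (h (f i)))
countᵇ-concatMap P h {zero}  f = refl
countᵇ-concatMap P h {suc n} f =
  trans (countᵇ-++ P (h (f 0F)) _) (cong (countᵇ P (h (f 0F)) +_) (countᵇ-concatMap P h (f ∘ F.suc)))

countᵇ-allPoints : ∀ {m} (P : Point m → Bool) →
  countᵇ P (allPoints m) ≡ sum (λ e → sum (λ c → bit (P (e , c))))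
countᵇ-allPoints {m} P = trans (countᵇ-concatMap P (λ e → map (e ,_) (tabulate id)) {m} id) (sum-cong-≗ block)
  where
  block : ∀ e → countᵇ P (map (e ,_) (tabulate id)) ≡ sum (λ c → bit (P (e , c)))
  block e = trans (cong (countᵇ P) (map-tabulate id (e ,_))) (countᵇ-tabulate P (e ,_))

allᵇ-cong : ∀ {f g : A → Bool} → f ≗ g → ∀ xs → allᵇ f xs ≡ allᵇ g xs
allᵇ-cong f≗g []       = refl
allᵇ-cong f≗g (x ∷ xs) = cong₂ _∧_ (f≗g x) (allᵇ-cong f≗g xs)

T-allᵇ-applyUpTo⁻ : ∀ (f : ℕ → Bool) h n → T (allᵇ f (applyUpTo h n)) → ∀ {j} → j < n → T (f (h j))
T-allᵇ-applyUpTo⁻ f h (suc n) t {zero}  _         = proj₁ (Equivalence.to T-∧ t)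
T-allᵇ-applyUpTo⁻ f h (suc n) t {suc j} (s≤s j<n) =
  T-allᵇ-applyUpTo⁻ f (h ∘ suc) n (proj₂ (Equivalence.to T-∧ t)) j<n

T-allᵇ-applyUpTo⁺ : ∀ (f : ℕ → Bool) h n → (∀ {j} → j < n → T (f (h j))) → T (allᵇ f (applyUpTo h n))
T-allᵇ-applyUpTo⁺ f h zero    all = _
T-allᵇ-applyUpTo⁺ f h (suc n) all =
  Equivalence.from T-∧ (all z<s , T-allᵇ-applyUpTo⁺ f (h ∘ suc) n (all ∘ s<s))

T-injective : ∀ {x y : Bool} → T x ⇔ T y → x ≡ y
T-injective {true}  {true}  _   = refl
T-injective {true}  {false} x⇔y = ⊥-elim (Equivalence.to x⇔y _)
T-injective {false} {true}  x⇔y = ⊥-elim (Equivalence.from x⇔y _)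
T-injective {false} {false} _   = refl

suc-≤⇔≤ : ∀ {a c} → a ≢ c → (suc a ≤ c ⇔ a ≤ c)
suc-≤⇔≤ a≢c = mk⇔ <⇒≤ (λ a≤c → ≤∧≢⇒< a≤c a≢c)

≤-suc⇔≤ : ∀ {a c} → c ≢ suc a → (c ≤ suc a ⇔ c ≤ a)
≤-suc⇔≤ c≢1+a = mk⇔ (λ c≤1+a → ≤-pred (≤∧≢⇒< c≤1+a c≢1+a)) m≤n⇒m≤1+n

four-copies : ∀ n → 4 * n ≡ (n + n) + (n + n)
four-copies = solve-∀

odd-double-< : ∀ {i n} → i < n → suc (i + i) < n + n
odd-double-< {i} {n} i<n = subst (_≤ n + n) (cong suc (+-suc i i)) (+-mono-≤ i<n i<n)


-- The corners of one edge

module _ {m : ℕ} (e : Fin m) where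

  atEdge-here : ∀ f c → atEdge e f (e , c) ≡ (e , f c)
  atEdge-here f c with e ≟ e
  ... | yes _   = refl
  ... | no e≢e = contradiction refl e≢e

  atEdge-elsewhere : ∀ f {e′} c → e′ ≢ e → atEdge e f (e′ , c) ≡ (e′ , c)
  atEdge-elsewhere f {e′} c e′≢e with e′ ≟ e
  ... | yes e′≡e = contradiction e′≡e e′≢e
  ... | no _     = refl

  atEdge-cong : ∀ {f g} → f ≗ g → atEdge e f ≗ atEdge e g
  atEdge-cong f≗g (e′ , c) with e′ ≟ e
  ... | yes _ = cong (e′ ,_) (f≗g c)
  ... | no _  = refl

  atEdge-id : ∀ {f} → f ≗ id → atEdge e f ≗ id
  atEdge-id f≗id (e′ , c) with e′ ≟ e
  ... | yes _ = cong (e′ ,_) (f≗id c)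
  ... | no _  = refl

  atEdge-∘ : ∀ f g → atEdge e f ∘ atEdge e g ≗ atEdge e (f ∘ g)
  atEdge-∘ f g (e′ , c) with e′ ≟ e
  ... | yes refl = atEdge-here f (g c)
  ... | no e′≢e  = atEdge-elsewhere f c e′≢e

  countᵇ-atEdge : ∀ (ρ : Permutation′ 4) (P : Point m → Bool) →
    countᵇ (P ∘ atEdge e (ρ ⟨$⟩ʳ_)) (allPoints m) ≡ countᵇ P (allPoints m)
  countᵇ-atEdge ρ P = begin
    countᵇ (P ∘ atEdge e (ρ ⟨$⟩ʳ_)) (allPoints m)                 ≡⟨ countᵇ-allPoints (P ∘ atEdge e (ρ ⟨$⟩ʳ_)) ⟩
    sum (λ e′ → sum (λ c → bit (P (atEdge e (ρ ⟨$⟩ʳ_) (e′ , c))))) ≡⟨ sum-cong-≗ block ⟩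
    sum (λ e′ → sum (λ c → bit (P (e′ , c))))                      ≡⟨ countᵇ-allPoints P ⟨
    countᵇ P (allPoints m)                                          ∎
    where
    open ≡-Reasoning
    block : ∀ e′ → sum (λ c → bit (P (atEdge e (ρ ⟨$⟩ʳ_) (e′ , c)))) ≡ sum (λ c → bit (P (e′ , c)))
    block e′ = case e′ ≟ e of λ where
      (yes refl) → trans (sum-cong-≗ (λ c → cong (bit ∘ P) (atEdge-here (ρ ⟨$⟩ʳ_) c)))
                         (sym (sum-permute (λ c → bit (P (e , c))) ρ))
      (no e′≢e)  → sum-cong-≗ (λ c → cong (bit ∘ P) (atEdge-elsewhere (ρ ⟨$⟩ʳ_) c e′≢e))

encode : ∀ {m} → Point m → Fin (m * 4)
encode (e , c) = combine e c

encode-injective : ∀ {m} {p q : Point m} → encode p ≡ encode q → p ≡ q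
encode-injective {p = e , c} {e′ , c′} eq with combine-injective e c e′ c′ eq
... | refl , refl = refl

rank-injective : ∀ {m} {p q : Point m} → rank p ≡ rank q → p ≡ q
rank-injective {p = e , c} {e′ , c′} eq =
  encode-injective (toℕ-injective (trans (toℕ-combine e c) (trans eq (sym (toℕ-combine e′ c′)))))

atEdge-injective : ∀ {m} (e : Fin m) (ρ : Permutation′ 4) {p q} →
  atEdge e (ρ ⟨$⟩ʳ_) p ≡ atEdge e (ρ ⟨$⟩ʳ_) q → p ≡ q
atEdge-injective e ρ {p} {q} eq = begin
  p                                            ≡⟨ undo p ⟨
  atEdge e (ρ ⟨$⟩ˡ_) (atEdge e (ρ ⟨$⟩ʳ_) p)    ≡⟨ cong (atEdge e (ρ ⟨$⟩ˡ_)) eq ⟩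
  atEdge e (ρ ⟨$⟩ˡ_) (atEdge e (ρ ⟨$⟩ʳ_) q)    ≡⟨ undo q ⟩
  q                                            ∎
  where
  open ≡-Reasoning
  undo : ∀ u → atEdge e (ρ ⟨$⟩ˡ_) (atEdge e (ρ ⟨$⟩ʳ_) u) ≡ u
  undo u = trans (atEdge-∘ e _ _ u) (atEdge-id e (λ _ → inverseˡ ρ) u)

transpose-matchˡ : ∀ {n} (i j : Fin n) → PC.transpose i j i ≡ j
transpose-matchˡ i j rewrite dec-true (i ≟ i) refl = refl

transpose-matchʳ : ∀ {n} (i j : Fin n) → PC.transpose i j j ≡ i
transpose-matchʳ i j with j ≟ i
... | yes j≡i = j≡i
... | no  _   rewrite dec-true (j ≟ j) refl = refl

transpose-fix : ∀ {n} {i j k : Fin n} → k ≢ i → k ≢ j → PC.transpose i j k ≡ k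
transpose-fix {i = i} {j} {k} k≢i k≢j rewrite dec-false (k ≟ i) k≢i | dec-false (k ≟ j) k≢j = refl


-- Closed curves of a pair of fixed-point-free involutions

trail : ∀ {m} → (Point m → Point m) → (Point m → Point m) → Point m → ℕ → Point m
trail g b p zero          = p
trail g b p (suc zero)    = g p
trail g b p (suc (suc j)) = b (g (trail g b p j))

isLeast : ∀ {m} → (Point m → Point m) → (Point m → Point m) → (Point m → ℕ) → Point m → Bool
isLeast {m} g b r p = allᵇ (λ j → r p ≤ᵇ r (trail g b p j)) (upTo (4 * m))

leastCount : ∀ {m} → (Point m → Point m) → (Point m → Point m) → (Point m → ℕ) → ℕ
leastCount {m} g b r = countᵇ (isLeast g b r) (allPoints m)

record FreeInvolution {m : ℕ} (f : Point m → Point m) : Set where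
  field
    involutive    : ∀ p → f (f p) ≡ p
    fixpoint-free : ∀ p → f p ≢ p

  injective : ∀ {p q} → f p ≡ f q → p ≡ q
  injective {p} {q} fp≡fq = trans (sym (involutive p)) (trans (cong f fp≡fq) (involutive q))

module Orbits {m : ℕ} {γ β : Point m → Point m}
  (γ-free : FreeInvolution γ) (β-free : FreeInvolution β) where

  private
    module Γ = FreeInvolution γ-free
    module Β = FreeInvolution β-free

  hop : Point m → Point m
  hop p = β (γ p)

  hops : ℕ → Point m → Point m
  hops zero    p = p
  hops (suc k) p = hop (hops k p)

  hop-injective : ∀ {p q} → hop p ≡ hop q → p ≡ q
  hop-injective = Γ.injective ∘ Β.injective

  hops-injective : ∀ k {p q} → hops k p ≡ hops k q → p ≡ q
  hops-injective zero    eq = eq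
  hops-injective (suc k) eq = hops-injective k (hop-injective eq)

  hops-+ : ∀ a b p → hops (a + b) p ≡ hops a (hops b p)
  hops-+ zero    b p = refl
  hops-+ (suc a) b p = cong hop (hops-+ a b p)

  hops-suc : ∀ k p → hops (suc k) p ≡ hops k (hop p)
  hops-suc k p = trans (cong (λ i → hops i p) (+-comm 1 k)) (hops-+ k 1 p)

  hop-γ-hop : ∀ q → hop (γ (hop q)) ≡ γ q
  hop-γ-hop q = trans (cong β (Γ.involutive (β (γ q)))) (Β.involutive (γ q))

  hops-γ-hops : ∀ k p → hops k (γ (hops k p)) ≡ γ p
  hops-γ-hops zero    p = refl
  hops-γ-hops (suc k) p = begin
    hops (suc k) (γ (hop (hops k p)))   ≡⟨ hops-suc k _ ⟩
    hops k (hop (γ (hop (hops k p))))   ≡⟨ cong (hops k) (hop-γ-hop (hops k p)) ⟩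
    hops k (γ (hops k p))               ≡⟨ hops-γ-hops k p ⟩
    γ p                                 ∎
    where open ≡-Reasoning

  -- Two hops around q and γ q cancel (hop-γ-hop), so an even number of hops
  -- from q to γ q would give a fixed point of γ, an odd number one of β.
  hops-≢-γ : ∀ k q → hops k q ≢ γ q
  hops-≢-γ zero          q eq = Γ.fixpoint-free q (sym eq)
  hops-≢-γ (suc zero)    q eq = Β.fixpoint-free (γ q) eq
  hops-≢-γ (suc (suc k)) q eq = hops-≢-γ k (hop q) (hop-injective (begin
    hop (hops k (hop q))        ≡⟨ cong hop (hops-suc k q) ⟨
    hops (suc (suc k)) q        ≡⟨ eq ⟩
    γ q                         ≡⟨ hop-γ-hop q ⟨
    hop (γ (hop q))             ∎))
    where open ≡-Reasoning

  hops-≢-γ-hops : ∀ i j p → hops i p ≢ γ (hops j p)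
  hops-≢-γ-hops i j p eq with ≤-total j i
  ... | inj₁ j≤i = hops-≢-γ (i ∸ j) (hops j p) (begin
    hops (i ∸ j) (hops j p)   ≡⟨ hops-+ (i ∸ j) j p ⟨
    hops (i ∸ j + j) p        ≡⟨ cong (λ k → hops k p) (m∸n+n≡m j≤i) ⟩
    hops i p                  ≡⟨ eq ⟩
    γ (hops j p)              ∎)
    where open ≡-Reasoning
  ... | inj₂ i≤j = hops-≢-γ (j ∸ i) (hops i p) (Γ.injective (begin
    γ (hops (j ∸ i) (hops i p))   ≡⟨ cong γ (hops-+ (j ∸ i) i p) ⟨
    γ (hops (j ∸ i + i) p)        ≡⟨ cong (λ k → γ (hops k p)) (m∸n+n≡m i≤j) ⟩
    γ (hops j p)                  ≡⟨ eq ⟨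
    hops i p                      ≡⟨ Γ.involutive (hops i p) ⟨
    γ (γ (hops i p))              ∎))
    where open ≡-Reasoning

  record Period (p : Point m) : Set where
    field
      length   : ℕ
      positive : 0 < length
      bounded  : length ≤ m + m
      closes   : hops length p ≡ p

  period-from-collision : ∀ {p a b} → a < b → b ≤ m + m → hops a p ≡ hops b p → Period p
  period-from-collision {p} {a} {b} a<b b≤ collision = record
    { length   = b ∸ a
    ; positive = m<n⇒0<n∸m a<b
    ; bounded  = ≤-trans (m∸n≤m b a) b≤
    ; closes   = hops-injective a (begin
        hops a (hops (b ∸ a) p)   ≡⟨ hops-+ a (b ∸ a) p ⟨
        hops (a + (b ∸ a)) p      ≡⟨ cong (λ k → hops k p) (m+[n∸m]≡n (<⇒≤ a<b)) ⟩
        hops b p                  ≡⟨ collision ⟨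
        hops a p                  ∎)
    }
    where open ≡-Reasoning

  -- Pigeonhole on the 2(2m+1) points hops i p and γ (hops i p), i ≤ 2m, among
  -- the 4m points: a collision between the two families is impossible.
  module _ (p : Point m) where
    private
      K : ℕ
      K = suc (m + m)

      position : Fin K ⊎ Fin K → Point m
      position (inj₁ a) = hops (toℕ a) p
      position (inj₂ a) = γ (hops (toℕ a) p)

      points<positions : m * 4 < K + K
      points<positions = s≤s (begin
        m * 4                ≡⟨ *-comm m 4 ⟩
        4 * m                ≡⟨ four-copies m ⟩
        (m + m) + (m + m)    ≤⟨ +-monoʳ-≤ (m + m) (n≤1+n (m + m)) ⟩
        (m + m) + K          ∎)
        where open ≤-Reasoning

      from-fin-collision : ∀ (a b : Fin K) → a ≢ b → hops (toℕ a) p ≡ hops (toℕ b) p → Period p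
      from-fin-collision a b a≢b eq with <-cmp (toℕ a) (toℕ b)
      ... | tri< a<b _ _ = period-from-collision a<b (toℕ≤pred[n] b) eq
      ... | tri≈ _ a≡b _ = contradiction (toℕ-injective a≡b) a≢b
      ... | tri> _ _ b<a = period-from-collision b<a (toℕ≤pred[n] a) (sym eq)

      from-collision : ∀ u v → u ≢ v → position u ≡ position v → Period p
      from-collision (inj₁ a) (inj₁ b) u≢v eq = from-fin-collision a b (u≢v ∘ cong inj₁) eq
      from-collision (inj₁ a) (inj₂ b) _   eq = contradiction eq (hops-≢-γ-hops (toℕ a) (toℕ b) p)
      from-collision (inj₂ a) (inj₁ b) _   eq = contradiction (sym eq) (hops-≢-γ-hops (toℕ b) (toℕ a) p)
      from-collision (inj₂ a) (inj₂ b) u≢v eq = from-fin-collision a b (u≢v ∘ cong inj₂) (Γ.injective eq)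

    -- abstract, so that the typechecker never evaluates the pigeonhole search
    abstract
     period : Period p
     period with pigeonhole points<positions (encode ∘ position ∘ splitAt K)
     ... | i , j , i<j , same = from-collision (splitAt K i) (splitAt K j) distinct (encode-injective same)
       where
       distinct : splitAt K i ≢ splitAt K j
       distinct eq = <⇒≢ i<j (begin
         i                      ≡⟨ join-splitAt K K i ⟨
         join K K (splitAt K i) ≡⟨ cong (join K K) eq ⟩
         join K K (splitAt K j) ≡⟨ join-splitAt K K j ⟩
         j                      ∎)
         where open ≡-Reasoning

  module _ (p : Point m) where
    open Period (period p)
    private instance
      length-nonZero : NonZero length
      length-nonZero = >-nonZero positive

    hops-multiple : ∀ q → hops (q * length) p ≡ p
    hops-multiple zero    = refl
    hops-multiple (suc q) = begin
      hops (length + q * length) p    ≡⟨ hops-+ length (q * length) p ⟩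
      hops length (hops (q * length) p) ≡⟨ cong (hops length) (hops-multiple q) ⟩
      hops length p                   ≡⟨ closes ⟩
      p                               ∎
      where open ≡-Reasoning

    hops-reduced : ∀ k → ∃[ i ] (i < m + m × hops k p ≡ hops i p)
    hops-reduced k = k % length , ≤-trans (m%n<n k length) bounded , (begin
      hops k p                                    ≡⟨ cong (λ i → hops i p) (m≡m%n+[m/n]*n k length) ⟩
      hops (k % length + (k / length) * length) p ≡⟨ hops-+ (k % length) _ p ⟩
      hops (k % length) (hops ((k / length) * length) p) ≡⟨ cong (hops (k % length)) (hops-multiple (k / length)) ⟩
      hops (k % length) p                         ∎)
      where open ≡-Reasoning

    hops-undo : ∀ k → ∃[ i ] hops i (hops k p) ≡ p
    hops-undo k = pred length * k , (begin
      hops (pred length * k) (hops k p) ≡⟨ hops-+ (pred length * k) k p ⟨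
      hops (pred length * k + k) p      ≡⟨ cong (λ i → hops i p) (+-comm (pred length * k) k) ⟩
      hops (suc (pred length) * k) p    ≡⟨ cong (λ i → hops (i * k) p) (suc-pred length) ⟩
      hops (length * k) p               ≡⟨ cong (λ i → hops i p) (*-comm length k) ⟩
      hops (k * length) p               ≡⟨ hops-multiple k ⟩
      p                                 ∎)
      where open ≡-Reasoning

  OnCurve : Point m → Point m → Set
  OnCurve p q = ∃[ k ] (q ≡ hops k p ⊎ q ≡ hops k (γ p))

  γ-hops : ∀ k p → ∃[ j ] γ (hops k p) ≡ hops j (γ p)
  γ-hops k p with hops-undo (γ (hops k p)) k
  ... | i , undo = i , trans (sym undo) (cong (hops i) (hops-γ-hops k p))

  on-curve-refl : ∀ p → OnCurve p p
  on-curve-refl p = 0 , inj₁ refl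

  on-curve-sym : ∀ {p q} → OnCurve p q → OnCurve q p
  on-curve-sym {p} (k , inj₁ refl) with hops-undo p k
  ... | i , undo = i , inj₁ (sym undo)
  on-curve-sym {p} (k , inj₂ refl) with γ-hops k (γ p)
  ... | j , shift with hops-undo p j
  ...   | i , undo = i , inj₂ (begin
    p                                 ≡⟨ undo ⟨
    hops i (hops j p)                 ≡⟨ cong (hops i ∘ hops j) (Γ.involutive p) ⟨
    hops i (hops j (γ (γ p)))         ≡⟨ cong (hops i) shift ⟨
    hops i (γ (hops k (γ p)))         ∎)
    where open ≡-Reasoning

  on-curve-trans : ∀ {p q r} → OnCurve p q → OnCurve q r → OnCurve p r
  on-curve-trans {p} (k , inj₁ refl) (l , inj₁ refl) = l + k , inj₁ (sym (hops-+ l k p))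
  on-curve-trans {p} (k , inj₂ refl) (l , inj₁ refl) = l + k , inj₂ (sym (hops-+ l k (γ p)))
  on-curve-trans {p} (k , inj₁ refl) (l , inj₂ refl) with γ-hops k p
  ... | j , shift = l + j , inj₂ (trans (cong (hops l) shift) (sym (hops-+ l j (γ p))))
  on-curve-trans {p} (k , inj₂ refl) (l , inj₂ refl) with γ-hops k (γ p)
  ... | j , shift = l + j , inj₁ (begin
    hops l (γ (hops k (γ p)))   ≡⟨ cong (hops l) shift ⟩
    hops l (hops j (γ (γ p)))   ≡⟨ cong (hops l ∘ hops j) (Γ.involutive p) ⟩
    hops l (hops j p)           ≡⟨ hops-+ l j p ⟨
    hops (l + j) p              ∎)
    where open ≡-Reasoning

  hop-on-curve : ∀ {p q} → OnCurve p q → OnCurve p (hop q)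
  hop-on-curve (k , inj₁ refl) = suc k , inj₁ refl
  hop-on-curve (k , inj₂ refl) = suc k , inj₂ refl

  trail-on-curve : ∀ p j → OnCurve p (trail γ β p j)
  trail-on-curve p zero          = on-curve-refl p
  trail-on-curve p (suc zero)    = 0 , inj₂ refl
  trail-on-curve p (suc (suc j)) = hop-on-curve (trail-on-curve p j)

  trail-even : ∀ k p → trail γ β p (k + k) ≡ hops k p
  trail-even zero    p = refl
  trail-even (suc k) p rewrite +-suc k k = cong hop (trail-even k p)

  trail-odd : ∀ k p → trail γ β p (suc (k + k)) ≡ hops k (γ p)
  trail-odd zero    p = refl
  trail-odd (suc k) p rewrite +-suc k k = cong hop (trail-odd k p)

  Reach : Point m → Point m → Set
  Reach p q = ∃[ j ] (j < 4 * m × trail γ β p j ≡ q)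

  within-trail : ∀ {j} → j < (m + m) + (m + m) → j < 4 * m
  within-trail {j} = subst (j <_) (sym (four-copies m))

  on-curve⇒reach : ∀ {p q} → OnCurve p q → Reach p q
  on-curve⇒reach {p} (k , inj₁ refl) with hops-reduced p k
  ... | i , i<2m , reduced = i + i , within-trail (<-trans (n<1+n (i + i)) (odd-double-< i<2m)) , trans (trail-even i p) (sym reduced)
  on-curve⇒reach {p} (k , inj₂ refl) with hops-reduced (γ p) k
  ... | i , i<2m , reduced = suc (i + i) , within-trail (odd-double-< i<2m) , trans (trail-odd i p) (sym reduced)

  reach⇒on-curve : ∀ {p q} → Reach p q → OnCurve p q
  reach⇒on-curve {p} (j , _ , refl) = trail-on-curve p j

  on-curve? : ∀ p q → Dec (OnCurve p q)
  on-curve? p q = map′ reach⇒on-curve on-curve⇒reach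
    (anyUpTo? (λ j → ≡-dec _≟_ _≟_ (trail γ β p j) q) (4 * m))

  IsLeast : (Point m → ℕ) → Point m → Set
  IsLeast r p = ∀ q → OnCurve p q → r p ≤ r q

  T-isLeast : ∀ r p → T (isLeast γ β r p) ⇔ IsLeast r p
  T-isLeast r p = mk⇔
    (λ t q p~q → case on-curve⇒reach p~q of λ where
      (j , j< , refl) → ≤ᵇ⇒≤ _ _ (T-allᵇ-applyUpTo⁻ _ id (4 * m) t j<))
    (λ least → T-allᵇ-applyUpTo⁺ _ id (4 * m) (λ {j} _ → ≤⇒≤ᵇ (least _ (trail-on-curve p j))))

  isLeast-≡ : ∀ r r′ p p′ → (IsLeast r p ⇔ IsLeast r′ p′) → isLeast γ β r p ≡ isLeast γ β r′ p′
  isLeast-≡ r r′ p p′ least⇔ =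
    T-injective (⇔-sym (T-isLeast r′ p′) ⇔-∘ (least⇔ ⇔-∘ T-isLeast r p))

  isLeast-along-curves : ∀ r (σ : Point m → Point m) → (∀ u → OnCurve u (σ u)) → (∀ u → σ (σ u) ≡ u) →
    ∀ p → isLeast γ β (r ∘ σ) p ≡ isLeast γ β r (σ p)
  isLeast-along-curves r σ along involutive p = isLeast-≡ (r ∘ σ) r p (σ p) (mk⇔ to from)
    where
    to : IsLeast (r ∘ σ) p → IsLeast r (σ p)
    to least q σp~q = subst (r (σ p) ≤_) (cong r (involutive q))
      (least (σ q) (on-curve-trans (on-curve-trans (along p) σp~q) (along q)))
    from : IsLeast r (σ p) → IsLeast (r ∘ σ) p
    from least q p~q = least (σ q) (on-curve-trans (on-curve-sym (along p)) (on-curve-trans p~q (along q)))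

  isLeast-order-preserving : ∀ r (σ : Point m → Point m) →
    (∀ u v → OnCurve u v → (r (σ u) ≤ r (σ v) ⇔ r u ≤ r v)) →
    ∀ p → isLeast γ β (r ∘ σ) p ≡ isLeast γ β r p
  isLeast-order-preserving r σ preserves p = isLeast-≡ (r ∘ σ) r p p (mk⇔
    (λ least q p~q → Equivalence.to   (preserves p q p~q) (least q p~q))
    (λ least q p~q → Equivalence.from (preserves p q p~q) (least q p~q)))

  module _ (r : Point m → ℕ) (r-injective : ∀ {p q} → r p ≡ r q → p ≡ q)
           (e : Fin m) (a b : Fin 4) (adjacent : r (e , b) ≡ suc (r (e , a))) where

    private
      x y : Point m
      x = e , a
      y = e , b

      σ : Point m → Point m
      σ = atEdge e (PC.transpose a b)

      σ-x : σ x ≡ y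
      σ-x = trans (atEdge-here e _ a) (cong (e ,_) (transpose-matchˡ a b))

      σ-y : σ y ≡ x
      σ-y = trans (atEdge-here e _ b) (cong (e ,_) (transpose-matchʳ a b))

      σ-fix : ∀ {u} → u ≢ x → u ≢ y → σ u ≡ u
      σ-fix {e′ , c} u≢x u≢y = case e′ ≟ e of λ where
        (yes refl) → trans (atEdge-here e _ c)
                           (cong (e ,_) (transpose-fix (u≢x ∘ cong (e ,_)) (u≢y ∘ cong (e ,_))))
        (no e′≢e)  → atEdge-elsewhere e _ c e′≢e

      data Location (u : Point m) : Set where
        at-x      : u ≡ x → Location u
        at-y      : u ≡ y → Location u
        elsewhere : u ≢ x → u ≢ y → Location u

      locate : ∀ u → Location u
      locate u with ≡-dec _≟_ _≟_ u x | ≡-dec _≟_ _≟_ u y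
      ... | yes u≡x | _       = at-x u≡x
      ... | no _    | yes u≡y = at-y u≡y
      ... | no u≢x  | no u≢y  = elsewhere u≢x u≢y

      σ-involutive : ∀ u → σ (σ u) ≡ u
      σ-involutive u with locate u
      ... | at-x refl          = trans (cong σ σ-x) σ-y
      ... | at-y refl          = trans (cong σ σ-y) σ-x
      ... | elsewhere u≢x u≢y  = trans (cong σ (σ-fix u≢x u≢y)) (σ-fix u≢x u≢y)

      σ-along-curves : OnCurve x y → ∀ u → OnCurve u (σ u)
      σ-along-curves x~y u with locate u
      ... | at-x refl         = subst (OnCurve x) (sym σ-x) x~y
      ... | at-y refl         = subst (OnCurve y) (sym σ-y) (on-curve-sym x~y)
      ... | elsewhere u≢x u≢y = subst (OnCurve u) (sym (σ-fix u≢x u≢y)) (on-curve-refl u)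

      r-x≢ : ∀ {u} → u ≢ x → r x ≢ r u
      r-x≢ u≢x = u≢x ∘ sym ∘ r-injective

      r≢-y : ∀ {u} → u ≢ y → r u ≢ suc (r x)
      r≢-y u≢y ru≡1+rx = u≢y (r-injective (trans ru≡1+rx (sym adjacent)))

      -- Since r y = r x + 1, no value of r lies strictly between r x and r y.
      σ-preserves-order : ¬ OnCurve x y → ∀ u v → OnCurve u v → (r (σ u) ≤ r (σ v) ⇔ r u ≤ r v)
      σ-preserves-order x≁y u v u~v with locate u | locate v
      ... | at-x refl | at-x refl = mk⇔ (λ _ → ≤-refl) (λ _ → ≤-refl)
      ... | at-y refl | at-y refl = mk⇔ (λ _ → ≤-refl) (λ _ → ≤-refl)
      ... | at-x refl | at-y refl = contradiction u~v x≁y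
      ... | at-y refl | at-x refl = contradiction (on-curve-sym u~v) x≁y
      ... | at-x refl | elsewhere v≢x v≢y
        rewrite σ-x | σ-fix v≢x v≢y | adjacent = suc-≤⇔≤ (r-x≢ v≢x)
      ... | at-y refl | elsewhere v≢x v≢y
        rewrite σ-y | σ-fix v≢x v≢y | adjacent = ⇔-sym (suc-≤⇔≤ (r-x≢ v≢x))
      ... | elsewhere u≢x u≢y | at-x refl
        rewrite σ-x | σ-fix u≢x u≢y | adjacent = ≤-suc⇔≤ (r≢-y u≢y)
      ... | elsewhere u≢x u≢y | at-y refl
        rewrite σ-y | σ-fix u≢x u≢y | adjacent = ⇔-sym (≤-suc⇔≤ (r≢-y u≢y))
      ... | elsewhere u≢x u≢y | elsewhere v≢x v≢y
        rewrite σ-fix u≢x u≢y | σ-fix v≢x v≢y = mk⇔ id id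

    leastCount-transpose : leastCount γ β (r ∘ atEdge e (PC.transpose a b)) ≡ leastCount γ β r
    leastCount-transpose with on-curve? x y
    ... | yes x~y = trans (countᵇ-cong (isLeast-along-curves r σ (σ-along-curves x~y) σ-involutive) (allPoints m))
                          (countᵇ-atEdge e (transpose a b) (isLeast γ β r))
    ... | no x≁y  = countᵇ-cong (isLeast-order-preserving r σ (σ-preserves-order x≁y)) (allPoints m)


-- Relabelling the corners of one edge

module Conjugation {m : ℕ} {γ β γ′ β′ σ σ′ : Point m → Point m}
  (σ∘σ′ : ∀ p → σ (σ′ p) ≡ p) (σ′∘σ : ∀ p → σ′ (σ p) ≡ p)
  (γ′-conj : ∀ p → γ′ p ≡ σ′ (γ (σ p))) (β′-conj : ∀ p → β′ p ≡ σ′ (β (σ p))) where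

  trail-conjugate : ∀ p j → trail γ′ β′ p j ≡ σ′ (trail γ β (σ p) j)
  trail-conjugate p zero          = sym (σ′∘σ p)
  trail-conjugate p (suc zero)    = γ′-conj p
  trail-conjugate p (suc (suc j)) = begin
    β′ (γ′ (trail γ′ β′ p j))                     ≡⟨ cong (β′ ∘ γ′) (trail-conjugate p j) ⟩
    β′ (γ′ (σ′ (trail γ β (σ p) j)))              ≡⟨ cong β′ (γ′-conj _) ⟩
    β′ (σ′ (γ (σ (σ′ (trail γ β (σ p) j)))))      ≡⟨ cong (β′ ∘ σ′ ∘ γ) (σ∘σ′ _) ⟩
    β′ (σ′ (γ (trail γ β (σ p) j)))               ≡⟨ β′-conj _ ⟩
    σ′ (β (σ (σ′ (γ (trail γ β (σ p) j)))))       ≡⟨ cong (σ′ ∘ β) (σ∘σ′ _) ⟩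
    σ′ (β (γ (trail γ β (σ p) j)))                ∎
    where open ≡-Reasoning

  isLeast-conjugate : ∀ r p → isLeast γ′ β′ r p ≡ isLeast γ β (r ∘ σ′) (σ p)
  isLeast-conjugate r p = allᵇ-cong
    (λ j → cong₂ _≤ᵇ_ (cong r (sym (σ′∘σ p))) (cong r (trail-conjugate p j))) (upTo (4 * m))

leastCount-cong : ∀ {m} {γ β γ′ β′ : Point m → Point m} {r r′ : Point m → ℕ} →
  γ′ ≗ γ → β′ ≗ β → r′ ≗ r → leastCount γ′ β′ r′ ≡ leastCount γ β r
leastCount-cong {m} {γ} {β} {r = r} {r′} γ′≗γ β′≗β r′≗r =
  countᵇ-cong (λ p → trans (isLeast-conjugate r′ p) (same-rank p)) (allPoints m)
  where
  open Conjugation {σ = id} {σ′ = id} (λ _ → refl) (λ _ → refl) γ′≗γ β′≗β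
  same-rank : ∀ p → isLeast γ β r′ p ≡ isLeast γ β r p
  same-rank p = allᵇ-cong (λ j → cong₂ _≤ᵇ_ (r′≗r p) (r′≗r _)) (upTo (4 * m))

leastCount-conjugateAt : ∀ {m} {γ β γ′ β′ : Point m → Point m} (e : Fin m) (ρ : Permutation′ 4) →
  (∀ p → γ′ p ≡ atEdge e (ρ ⟨$⟩ˡ_) (γ (atEdge e (ρ ⟨$⟩ʳ_) p))) →
  (∀ p → β′ p ≡ atEdge e (ρ ⟨$⟩ˡ_) (β (atEdge e (ρ ⟨$⟩ʳ_) p))) →
  ∀ r → leastCount γ′ β′ r ≡ leastCount γ β (r ∘ atEdge e (ρ ⟨$⟩ˡ_))
leastCount-conjugateAt {m} {γ} {β} {γ′} {β′} e ρ γ′-conj β′-conj r =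
  trans (countᵇ-cong (isLeast-conjugate r) (allPoints m))
        (countᵇ-atEdge e ρ (isLeast γ β (r ∘ atEdge e (ρ ⟨$⟩ˡ_))))
  where
  open Conjugation {γ = γ} {β} {γ′} {β′} {atEdge e (ρ ⟨$⟩ʳ_)} {atEdge e (ρ ⟨$⟩ˡ_)}
    (λ p → trans (atEdge-∘ e _ _ p) (atEdge-id e (λ _ → inverseʳ ρ) p))
    (λ p → trans (atEdge-∘ e _ _ p) (atEdge-id e (λ _ → inverseˡ ρ) p))
    γ′-conj β′-conj

-- Built from the identity by transpositions of two corners whose current
-- images are consecutive, i.e. a bubble sort run backwards.
data AdjacentTranspositions : Permutation′ 4 → Set where
  identity : AdjacentTranspositions Perm.id
  swap     : ∀ {ρ} → AdjacentTranspositions ρ → ∀ a b → toℕ (ρ ⟨$⟩ʳ b) ≡ suc (toℕ (ρ ⟨$⟩ʳ a)) →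
             AdjacentTranspositions (transpose a b ∘ₚ ρ)

module _ {m : ℕ} {γ β : Point m → Point m}
  (γ-free : FreeInvolution γ) (β-free : FreeInvolution β) (e : Fin m) where

  open Orbits γ-free β-free using (leastCount-transpose)

  leastCount-relabel : ∀ {ρ} → AdjacentTranspositions ρ →
    leastCount γ β (rank ∘ atEdge e (ρ ⟨$⟩ʳ_)) ≡ leastCount γ β rank
  leastCount-relabel identity = leastCount-cong (λ _ → refl) (λ _ → refl) (cong rank ∘ atEdge-id e (λ _ → refl))
  leastCount-relabel (swap {ρ} rest a b consecutive) = begin
    leastCount γ β (rank ∘ atEdge e ((ρ ⟨$⟩ʳ_) ∘ PC.transpose a b))
      ≡⟨ leastCount-cong (λ _ → refl) (λ _ → refl) (cong rank ∘ sym ∘ atEdge-∘ e (ρ ⟨$⟩ʳ_) (PC.transpose a b)) ⟩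
    leastCount γ β (r ∘ atEdge e (PC.transpose a b))
      ≡⟨ leastCount-transpose r (atEdge-injective e ρ ∘ rank-injective) e a b adjacent ⟩
    leastCount γ β r
      ≡⟨ leastCount-relabel rest ⟩
    leastCount γ β rank
      ∎
    where
    open ≡-Reasoning
    r : Point m → ℕ
    r = rank ∘ atEdge e (ρ ⟨$⟩ʳ_)
    adjacent : r (e , b) ≡ suc (r (e , a))
    adjacent rewrite atEdge-here e (ρ ⟨$⟩ʳ_) a | atEdge-here e (ρ ⟨$⟩ʳ_) b =
      trans (cong (4 * toℕ e +_) consecutive) (+-suc (4 * toℕ e) _)


-- Vertex states

-- All vertex states of the medial graph; Penrose states are those avoiding black.
data Split : Set where
  black white cross : Split

blackSplit : Fin 4 → Fin 4
blackSplit 0F = 1F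
blackSplit 1F = 0F
blackSplit 2F = 3F
blackSplit 3F = 2F

pairing : Split → Fin 4 → Fin 4
pairing black = blackSplit
pairing white = whiteSplit
pairing cross = crossing

pairing-involutive : ∀ v c → pairing v (pairing v c) ≡ c
pairing-involutive black = λ { 0F → refl ; 1F → refl ; 2F → refl ; 3F → refl }
pairing-involutive white = λ { 0F → refl ; 1F → refl ; 2F → refl ; 3F → refl }
pairing-involutive cross = λ { 0F → refl ; 1F → refl ; 2F → refl ; 3F → refl }

pairing-fixpoint-free : ∀ v c → pairing v c ≢ c
pairing-fixpoint-free black = λ { 0F () ; 1F () ; 2F () ; 3F () }
pairing-fixpoint-free white = λ { 0F () ; 1F () ; 2F () ; 3F () }
pairing-fixpoint-free cross = λ { 0F () ; 1F () ; 2F () ; 3F () }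

toSplit : VState → Split
toSplit white = white
toSplit cross = cross

rotation : Permutation′ 4
rotation = permutation rot rot⁻¹
  (λ { 0F → refl ; 1F → refl ; 2F → refl ; 3F → refl })
  (λ { 0F → refl ; 1F → refl ; 2F → refl ; 3F → refl })

arrowReversal : Permutation′ 4
arrowReversal = permutation swapA swapA
  (λ { 0F → refl ; 1F → refl ; 2F → refl ; 3F → refl })
  (λ { 0F → refl ; 1F → refl ; 2F → refl ; 3F → refl })

module _ {m : ℕ} where

  pairAll : Vec Split m → Point m → Point m
  pairAll t (e , c) = e , pairing (lookup t e) c

  pairAll-free : ∀ t → FreeInvolution (pairAll t)
  pairAll-free t = record
    { involutive    = λ { (e , c) → cong (e ,_) (pairing-involutive (lookup t e) c) }
    ; fixpoint-free = λ { (e , c) eq → pairing-fixpoint-free (lookup t e) c (cong proj₂ eq) }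
    }

  curvesˣ : EGraph m → Vec Split m → ℕ
  curvesˣ G t = iso G + leastCount (γ G) (pairAll t) rank

  walk≡trail : ∀ (G : EGraph m) s p j → walk G s p j ≡ trail (γ G) (β s) p j
  walk≡trail G s p zero          = refl
  walk≡trail G s p (suc zero)    = refl
  walk≡trail G s p (suc (suc j)) = cong (β s ∘ γ G) (walk≡trail G s p j)

  β≗pairAll : ∀ s → β s ≗ pairAll (mapᵛ toSplit s)
  β≗pairAll s (e , c) rewrite lookup-map e toSplit s with lookup s e
  ... | white = refl
  ... | cross = refl

  curves≡curvesˣ : ∀ (G : EGraph m) s → curves G s ≡ curvesˣ G (mapᵛ toSplit s)
  curves≡curvesˣ G s = cong (iso G +_) (trans
    (countᵇ-cong (λ p → allᵇ-cong (λ j → cong (λ q → rank p ≤ᵇ rank q) (walk≡trail G s p j)) (upTo (4 * m)))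
                 (allPoints m))
    (leastCount-cong {γ = γ G} {r = rank} (λ _ → refl) (β≗pairAll s) (λ _ → refl)))

  conjugateAt : Fin m → Permutation′ 4 → EGraph m → EGraph m
  conjugateAt e ρ G = record
    { iso = iso G
    ; γ   = atEdge e (ρ ⟨$⟩ˡ_) ∘ γ G ∘ atEdge e (ρ ⟨$⟩ʳ_)
    }

  conjugateAt-∘ : ∀ e ρ π (G : EGraph m) →
    γ (conjugateAt e ρ (conjugateAt e π G)) ≗ γ (conjugateAt e (ρ ∘ₚ π) G)
  conjugateAt-∘ e ρ π G p = begin
    atEdge e (ρ ⟨$⟩ˡ_) (atEdge e (π ⟨$⟩ˡ_) (γ G (atEdge e (π ⟨$⟩ʳ_) (atEdge e (ρ ⟨$⟩ʳ_) p))))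
      ≡⟨ atEdge-∘ e _ _ _ ⟩
    atEdge e ((ρ ⟨$⟩ˡ_) ∘ (π ⟨$⟩ˡ_)) (γ G (atEdge e (π ⟨$⟩ʳ_) (atEdge e (ρ ⟨$⟩ʳ_) p)))
      ≡⟨ cong (atEdge e _ ∘ γ G) (atEdge-∘ e _ _ p) ⟩
    atEdge e ((ρ ⟨$⟩ˡ_) ∘ (π ⟨$⟩ˡ_)) (γ G (atEdge e ((π ⟨$⟩ʳ_) ∘ (ρ ⟨$⟩ʳ_)) p))
      ∎
    where open ≡-Reasoning

  γ-δ : ∀ (G : EGraph m) e → γ (δ G e) ≗ γ (conjugateAt e rotation G)
  γ-δ G e p = refl

  γ-δτ : ∀ (G : EGraph m) e → γ (δ (τ G e) e) ≗ γ (conjugateAt e (rotation ∘ₚ arrowReversal) G)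
  γ-δτ G e = conjugateAt-∘ e rotation arrowReversal G

  γ-δτδ : ∀ (G : EGraph m) e →
    γ (δ (τ (δ G e) e) e) ≗ γ (conjugateAt e (rotation ∘ₚ arrowReversal ∘ₚ rotation) G)
  γ-δτδ G e p = trans
    (cong (atEdge e rot⁻¹) (conjugateAt-∘ e arrowReversal rotation G (atEdge e rot p)))
    (conjugateAt-∘ e rotation (arrowReversal ∘ₚ rotation) G p)

  pairAll-conjugate : ∀ (e : Fin m) (ρ : Permutation′ 4) t v →
    (∀ c → ρ ⟨$⟩ˡ pairing v (ρ ⟨$⟩ʳ c) ≡ pairing (lookup t e) c) →
    ∀ p → pairAll t p ≡ atEdge e (ρ ⟨$⟩ˡ_) (pairAll (t [ e ]≔ v) (atEdge e (ρ ⟨$⟩ʳ_) p))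
  pairAll-conjugate e ρ t v conj (e′ , c) = (case e′ ≟ e of λ where
    (yes refl) → sym (begin
      atEdge e (ρ ⟨$⟩ˡ_) (pairAll (t [ e ]≔ v) (atEdge e (ρ ⟨$⟩ʳ_) (e , c)))
        ≡⟨ cong (atEdge e (ρ ⟨$⟩ˡ_) ∘ pairAll (t [ e ]≔ v)) (atEdge-here e _ c) ⟩
      atEdge e (ρ ⟨$⟩ˡ_) (e , pairing (lookup (t [ e ]≔ v) e) (ρ ⟨$⟩ʳ c))
        ≡⟨ atEdge-here e _ _ ⟩
      e , ρ ⟨$⟩ˡ pairing (lookup (t [ e ]≔ v) e) (ρ ⟨$⟩ʳ c)
        ≡⟨ cong (λ w → e , ρ ⟨$⟩ˡ pairing w (ρ ⟨$⟩ʳ c)) (lookup∘update e t v) ⟩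
      e , ρ ⟨$⟩ˡ pairing v (ρ ⟨$⟩ʳ c)
        ≡⟨ cong (e ,_) (conj c) ⟩
      e , pairing (lookup t e) c
        ∎)
    (no e′≢e) → sym (begin
      atEdge e (ρ ⟨$⟩ˡ_) (pairAll (t [ e ]≔ v) (atEdge e (ρ ⟨$⟩ʳ_) (e′ , c)))
        ≡⟨ cong (atEdge e (ρ ⟨$⟩ˡ_) ∘ pairAll (t [ e ]≔ v)) (atEdge-elsewhere e _ c e′≢e) ⟩
      atEdge e (ρ ⟨$⟩ˡ_) (e′ , pairing (lookup (t [ e ]≔ v) e′) c)
        ≡⟨ atEdge-elsewhere e _ _ e′≢e ⟩
      e′ , pairing (lookup (t [ e ]≔ v) e′) c
        ≡⟨ cong (λ w → e′ , pairing w c) (lookup∘update′ e′≢e t v) ⟩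
      e′ , pairing (lookup t e′) c
        ∎))
    where open ≡-Reasoning

  curvesˣ-conjugateAt : ∀ (G : EGraph m) → FreeInvolution (γ G) → (e : Fin m) (ρ : Permutation′ 4) →
    (π : Permutation′ 4) → AdjacentTranspositions π → (π ⟨$⟩ʳ_) ≗ (ρ ⟨$⟩ˡ_) → ∀ t v →
    (∀ c → ρ ⟨$⟩ˡ pairing v (ρ ⟨$⟩ʳ c) ≡ pairing (lookup t e) c) →
    curvesˣ (conjugateAt e ρ G) t ≡ curvesˣ G (t [ e ]≔ v)
  curvesˣ-conjugateAt G γ-free e ρ π sorts π≗ρ⁻¹ t v conj = cong (iso G +_) (begin
    leastCount (γ (conjugateAt e ρ G)) (pairAll t) rank
      ≡⟨ leastCount-conjugateAt e ρ (λ _ → refl) (pairAll-conjugate e ρ t v conj) rank ⟩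
    leastCount (γ G) (pairAll (t [ e ]≔ v)) (rank ∘ atEdge e (ρ ⟨$⟩ˡ_))
      ≡⟨ leastCount-cong (λ _ → refl) (λ _ → refl) (cong rank ∘ atEdge-cong e (sym ∘ π≗ρ⁻¹)) ⟩
    leastCount (γ G) (pairAll (t [ e ]≔ v)) (rank ∘ atEdge e (π ⟨$⟩ʳ_))
      ≡⟨ leastCount-relabel γ-free (pairAll-free (t [ e ]≔ v)) e sorts ⟩
    leastCount (γ G) (pairAll (t [ e ]≔ v)) rank
      ∎)
    where open ≡-Reasoning

  curves-conjugateAt : ∀ (G X : EGraph m) → Valid G → (e : Fin m) (ρ π : Permutation′ 4) →
    γ X ≗ γ (conjugateAt e ρ G) → iso X ≡ iso G →
    AdjacentTranspositions π → (π ⟨$⟩ʳ_) ≗ (ρ ⟨$⟩ˡ_) →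
    ∀ s w v → (∀ c → ρ ⟨$⟩ˡ pairing v (ρ ⟨$⟩ʳ c) ≡ pairing (toSplit w) c) →
    curves X (s [ e ]≔ w) ≡ curvesˣ G (mapᵛ toSplit s [ e ]≔ v)
  curves-conjugateAt G X valid e ρ π γX iso-X sorts π≗ρ⁻¹ s w v conj = begin
    curves X (s [ e ]≔ w)
      ≡⟨ curves≡curvesˣ X (s [ e ]≔ w) ⟩
    curvesˣ X t
      ≡⟨ cong₂ _+_ iso-X (leastCount-cong {β = pairAll t} {r = rank} γX (λ _ → refl) (λ _ → refl)) ⟩
    curvesˣ (conjugateAt e ρ G) t
      ≡⟨ curvesˣ-conjugateAt G γ-free e ρ π sorts π≗ρ⁻¹ t v
           (λ c → trans (conj c) (cong (λ u → pairing u c) (sym lookup-t-e))) ⟩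
    curvesˣ G (t [ e ]≔ v)
      ≡⟨ cong (curvesˣ G) (trans (cong (_[ e ]≔ v) (map-[]≔ toSplit s e)) ([]≔-idempotent _ e)) ⟩
    curvesˣ G (mapᵛ toSplit s [ e ]≔ v)
      ∎
    where
    open ≡-Reasoning
    t : Vec Split m
    t = mapᵛ toSplit (s [ e ]≔ w)
    lookup-t-e : lookup t e ≡ toSplit w
    lookup-t-e = trans (lookup-map e toSplit (s [ e ]≔ w)) (cong toSplit (lookup∘update e s w))
    γ-free : FreeInvolution (γ G)
    γ-free = record { involutive = Valid.γ-invol valid ; fixpoint-free = Valid.γ-fpf valid }


-- Signed sums over Penrose states

sumℤ : (A → ℤ) → List A → ℤ
sumℤ F xs = foldr _+ℤ_ 0ℤ (map F xs)

sumℤ-++ : ∀ (F : A → ℤ) xs ys → sumℤ F (xs ++ ys) ≡ sumℤ F xs +ℤ sumℤ F ys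
sumℤ-++ F []       ys = sym (ℤ.+-identityˡ _)
sumℤ-++ F (x ∷ xs) ys = trans (cong (F x +ℤ_) (sumℤ-++ F xs ys)) (sym (ℤ.+-assoc (F x) _ _))

sumℤ-cong : ∀ {F H : A → ℤ} → F ≗ H → ∀ xs → sumℤ F xs ≡ sumℤ H xs
sumℤ-cong F≗H []       = refl
sumℤ-cong F≗H (x ∷ xs) = cong₂ _+ℤ_ (F≗H x) (sumℤ-cong F≗H xs)

sumℤ-concatMap : ∀ (F : A → ℤ) (g : B → List A) xs →
  sumℤ F (concatMap g xs) ≡ sumℤ (λ x → sumℤ F (g x)) xs
sumℤ-concatMap F g []       = refl
sumℤ-concatMap F g (x ∷ xs) =
  trans (sumℤ-++ F (g x) (concatMap g xs)) (cong (sumℤ F (g x) +ℤ_) (sumℤ-concatMap F g xs))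

sumℤ-additive : ∀ (_∙_ : ℤ → ℤ → ℤ) → (∀ a b c d → (a +ℤ b) ∙ (c +ℤ d) ≡ (a ∙ c) +ℤ (b ∙ d)) →
  0ℤ ∙ 0ℤ ≡ 0ℤ → ∀ (F H : A → ℤ) xs → sumℤ (λ x → F x ∙ H x) xs ≡ sumℤ F xs ∙ sumℤ H xs
sumℤ-additive _∙_ interchange ∙-zero F H []       = sym ∙-zero
sumℤ-additive _∙_ interchange ∙-zero F H (x ∷ xs) =
  trans (cong (F x ∙ H x +ℤ_) (sumℤ-additive _∙_ interchange ∙-zero F H xs)) (sym (interchange _ _ _ _))

sumStates : ∀ {m} → (PState m → ℤ) → ℤ
sumStates {m} F = sumℤ F (allPStates m)

sumStates-suc : ∀ {m} (F : PState (suc m) → ℤ) →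
  sumStates F ≡ sumStates (λ s → F (white ∷ s) +ℤ F (cross ∷ s))
sumStates-suc {m} F = trans (sumℤ-concatMap F _ (allPStates m))
  (sumℤ-cong (λ s → cong (F (white ∷ s) +ℤ_) (ℤ.+-identityʳ (F (cross ∷ s)))) (allPStates m))

sumStates-pairs : ∀ {m} (e : Fin m) (F : PState m → ℤ) →
  sumStates (λ s → F (s [ e ]≔ white) +ℤ F (s [ e ]≔ cross)) ≡ sumStates F +ℤ sumStates F
sumStates-pairs {suc m} 0F F = begin
  sumStates (λ s → F (s [ 0F ]≔ white) +ℤ F (s [ 0F ]≔ cross))
    ≡⟨ sumStates-suc (λ s → F (s [ 0F ]≔ white) +ℤ F (s [ 0F ]≔ cross)) ⟩
  sumStates (λ s → H s +ℤ H s)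
    ≡⟨ sumℤ-additive _+ℤ_ ℤ+-interchange refl H H (allPStates m) ⟩
  sumStates H +ℤ sumStates H
    ≡⟨ cong₂ _+ℤ_ (sumStates-suc F) (sumStates-suc F) ⟨
  sumStates F +ℤ sumStates F
    ∎
  where
  open ≡-Reasoning
  H : PState m → ℤ
  H s = F (white ∷ s) +ℤ F (cross ∷ s)
sumStates-pairs {suc m} (F.suc e) F = begin
  sumStates (λ s → F (s [ F.suc e ]≔ white) +ℤ F (s [ F.suc e ]≔ cross))
    ≡⟨ sumStates-suc (λ s → F (s [ F.suc e ]≔ white) +ℤ F (s [ F.suc e ]≔ cross)) ⟩
  sumStates (λ s → (F (white ∷ (s [ e ]≔ white)) +ℤ F (white ∷ (s [ e ]≔ cross)))
             +ℤ (F (cross ∷ (s [ e ]≔ white)) +ℤ F (cross ∷ (s [ e ]≔ cross))))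
    ≡⟨ sumℤ-cong (λ s → ℤ+-interchange (F (white ∷ (s [ e ]≔ white))) (F (white ∷ (s [ e ]≔ cross)))
                                       (F (cross ∷ (s [ e ]≔ white))) (F (cross ∷ (s [ e ]≔ cross))))
                 (allPStates m) ⟩
  sumStates (λ s → H (s [ e ]≔ white) +ℤ H (s [ e ]≔ cross))
    ≡⟨ sumStates-pairs e H ⟩
  sumStates H +ℤ sumStates H
    ≡⟨ cong₂ _+ℤ_ (sumStates-suc F) (sumStates-suc F) ⟨
  sumStates F +ℤ sumStates F
    ∎
  where
  open ≡-Reasoning
  H : PState m → ℤ
  H s = F (white ∷ s) +ℤ F (cross ∷ s)

double-injective : ∀ {x y : ℤ} → x +ℤ x ≡ y +ℤ y → x ≡ y
double-injective {x} {y} eq = ℤ.*-cancelˡ-≡ (1ℤ +ℤ 1ℤ) x y (begin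
  (1ℤ +ℤ 1ℤ) *ℤ x  ≡⟨ twice x ⟩
  x +ℤ x           ≡⟨ eq ⟩
  y +ℤ y           ≡⟨ twice y ⟨
  (1ℤ +ℤ 1ℤ) *ℤ y  ∎)
  where
  open ≡-Reasoning
  twice : ∀ z → (1ℤ +ℤ 1ℤ) *ℤ z ≡ z +ℤ z
  twice = ℤ-solve-∀

−-interchange : ∀ a b c d → (a +ℤ b) -ℤ (c +ℤ d) ≡ (a -ℤ c) +ℤ (b -ℤ d)
−-interchange = ℤ-solve-∀

crossings-cross : ∀ {m} (s : PState m) e → crossings (s [ e ]≔ cross) ≡ suc (crossings (s [ e ]≔ white))
crossings-cross (_     ∷ s) 0F        = refl
crossings-cross (white ∷ s) (F.suc e) = crossings-cross s e
crossings-cross (cross ∷ s) (F.suc e) = cong suc (crossings-cross s e)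

module Coefficient {m : ℕ} (e : Fin m) (n : ℕ) where

  term : EGraph m → PState m → ℤ
  term X s = if curves X s ≡ᵇ n then sign (crossings s) else 0ℤ

  weight : ℕ → ℤ → ℤ
  weight c x = if c ≡ᵇ n then x else 0ℤ

  weight-neg : ∀ c x → weight c (- x) ≡ - weight c x
  weight-neg c x with c ≡ᵇ n
  ... | true  = refl
  ... | false = refl

  pairTerm : EGraph m → PState m → ℤ
  pairTerm X s = term X (s [ e ]≔ white) +ℤ term X (s [ e ]≔ cross)

  pairTerm-weights : ∀ X s → pairTerm X s ≡
    weight (curves X (s [ e ]≔ white)) (sign (crossings (s [ e ]≔ white)))
      -ℤ weight (curves X (s [ e ]≔ cross)) (sign (crossings (s [ e ]≔ white)))
  pairTerm-weights X s = cong (term X (s [ e ]≔ white) +ℤ_)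
    (trans (cong (weight (curves X (s [ e ]≔ cross)) ∘ sign) (crossings-cross s e))
           (weight-neg (curves X (s [ e ]≔ cross)) (sign (crossings (s [ e ]≔ white)))))

  penrose-by-pairs : ∀ (_∙_ : ℤ → ℤ → ℤ) → (∀ a b c d → (a +ℤ b) ∙ (c +ℤ d) ≡ (a ∙ c) +ℤ (b ∙ d)) →
    0ℤ ∙ 0ℤ ≡ 0ℤ → ∀ (G A B : EGraph m) → (∀ s → pairTerm G s ≡ pairTerm A s ∙ pairTerm B s) →
    penrose G n ≡ penrose A n ∙ penrose B n
  penrose-by-pairs _∙_ interchange ∙-zero G A B pairs = double-injective (begin
    penrose G n +ℤ penrose G n
      ≡⟨ sumStates-pairs e (term G) ⟨
    sumStates (pairTerm G)
      ≡⟨ sumℤ-cong pairs (allPStates m) ⟩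
    sumStates (λ s → pairTerm A s ∙ pairTerm B s)
      ≡⟨ sumℤ-additive _∙_ interchange ∙-zero (pairTerm A) (pairTerm B) (allPStates m) ⟩
    sumStates (pairTerm A) ∙ sumStates (pairTerm B)
      ≡⟨ cong₂ _∙_ (sumStates-pairs e (term A)) (sumStates-pairs e (term B)) ⟩
    (penrose A n +ℤ penrose A n) ∙ (penrose B n +ℤ penrose B n)
      ≡⟨ interchange _ _ _ _ ⟩
    (penrose A n ∙ penrose B n) +ℤ (penrose A n ∙ penrose B n)
      ∎)
    where open ≡-Reasoning

module PairTerms {m : ℕ} (G : EGraph m) (valid : Valid G) (e : Fin m) (n : ℕ) where

  open Coefficient e n

  ω : PState m → Split → ℤ
  ω s v = weight (curvesˣ G (mapᵛ toSplit s [ e ]≔ v)) (sign (crossings (s [ e ]≔ white)))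

  pairTerm-conjugateAt : ∀ X ρ π → γ X ≗ γ (conjugateAt e ρ G) → iso X ≡ iso G →
    AdjacentTranspositions π → (π ⟨$⟩ʳ_) ≗ (ρ ⟨$⟩ˡ_) → ∀ v w →
    (∀ c → ρ ⟨$⟩ˡ pairing v (ρ ⟨$⟩ʳ c) ≡ whiteSplit c) →
    (∀ c → ρ ⟨$⟩ˡ pairing w (ρ ⟨$⟩ʳ c) ≡ crossing c) →
    ∀ s → pairTerm X s ≡ ω s v -ℤ ω s w
  pairTerm-conjugateAt X ρ π γX iso-X sorts π≗ρ⁻¹ v w at-white at-cross s = trans (pairTerm-weights X s)
    (cong₂ (λ c c′ → weight c σ -ℤ weight c′ σ)
      (curves-conjugateAt G X valid e ρ π γX iso-X sorts π≗ρ⁻¹ s white v at-white)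
      (curves-conjugateAt G X valid e ρ π γX iso-X sorts π≗ρ⁻¹ s cross w at-cross))
    where
    σ : ℤ
    σ = sign (crossings (s [ e ]≔ white))

  pairs-G : ∀ s → pairTerm G s ≡ ω s white -ℤ ω s cross
  pairs-G = pairTerm-conjugateAt G Perm.id Perm.id
    (λ p → sym (trans (atEdge-id e (λ _ → refl) _) (cong (γ G) (atEdge-id e (λ _ → refl) p))))
    refl identity (λ _ → refl) white cross
    (λ { 0F → refl ; 1F → refl ; 2F → refl ; 3F → refl })
    (λ { 0F → refl ; 1F → refl ; 2F → refl ; 3F → refl })

  pairs-δ : ∀ s → pairTerm (δ G e) s ≡ ω s black -ℤ ω s cross
  pairs-δ = pairTerm-conjugateAt (δ G e) rotation _ (γ-δ G e) refl
    (swap (swap (swap identity 0F 1F refl) 0F 2F refl) 0F 3F refl)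
    (λ { 0F → refl ; 1F → refl ; 2F → refl ; 3F → refl }) black cross
    (λ { 0F → refl ; 1F → refl ; 2F → refl ; 3F → refl })
    (λ { 0F → refl ; 1F → refl ; 2F → refl ; 3F → refl })

  pairs-δτ : ∀ s → pairTerm (δ (τ G e) e) s ≡ ω s black -ℤ ω s white
  pairs-δτ = pairTerm-conjugateAt (δ (τ G e) e) (rotation ∘ₚ arrowReversal) _
    (γ-δτ G e) refl
    (swap (swap identity 1F 2F refl) 1F 3F refl)
    (λ { 0F → refl ; 1F → refl ; 2F → refl ; 3F → refl }) black white
    (λ { 0F → refl ; 1F → refl ; 2F → refl ; 3F → refl })
    (λ { 0F → refl ; 1F → refl ; 2F → refl ; 3F → refl })

  pairs-δτδ : ∀ s → pairTerm (δ (τ (δ G e) e) e) s ≡ ω s white -ℤ ω s black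
  pairs-δτδ = pairTerm-conjugateAt (δ (τ (δ G e) e) e) (rotation ∘ₚ arrowReversal ∘ₚ rotation) _
    (γ-δτδ G e) refl
    (swap (swap (swap identity 0F 1F refl) 2F 3F refl) 0F 3F refl)
    (λ { 0F → refl ; 1F → refl ; 2F → refl ; 3F → refl }) white black
    (λ { 0F → refl ; 1F → refl ; 2F → refl ; 3F → refl })
    (λ { 0F → refl ; 1F → refl ; 2F → refl ; 3F → refl })

  difference-identity : ∀ w x b → w -ℤ x ≡ (b -ℤ x) -ℤ (b -ℤ w)
  difference-identity = ℤ-solve-∀

  sum-identity : ∀ w x b → w -ℤ x ≡ (b -ℤ x) +ℤ (w -ℤ b)
  sum-identity = ℤ-solve-∀

theorem5p2 : {m : ℕ} (G : EGraph m) → Valid G → (e : Fin m) → (n : ℕ) →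
    (penrose G n ≡ penrose (δ G e) n -ℤ penrose (δ (τ G e) e) n)
    × (penrose G n ≡ penrose (δ G e) n +ℤ penrose (δ (τ (δ G e) e) e) n)
theorem5p2 G valid e n =
    penrose-by-pairs _-ℤ_ −-interchange refl G (δ G e) (δ (τ G e) e) (λ s → begin
      pairTerm G s                                   ≡⟨ pairs-G s ⟩
      ω s white -ℤ ω s cross                         ≡⟨ difference-identity (ω s white) (ω s cross) (ω s black) ⟩
      (ω s black -ℤ ω s cross) -ℤ (ω s black -ℤ ω s white) ≡⟨ cong₂ _-ℤ_ (pairs-δ s) (pairs-δτ s) ⟨
      pairTerm (δ G e) s -ℤ pairTerm (δ (τ G e) e) s ∎)
  , penrose-by-pairs _+ℤ_ ℤ+-interchange refl G (δ G e) (δ (τ (δ G e) e) e) (λ s → begin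
      pairTerm G s                                   ≡⟨ pairs-G s ⟩
      ω s white -ℤ ω s cross                         ≡⟨ sum-identity (ω s white) (ω s cross) (ω s black) ⟩
      (ω s black -ℤ ω s cross) +ℤ (ω s white -ℤ ω s black) ≡⟨ cong₂ _+ℤ_ (pairs-δ s) (pairs-δτδ s) ⟨
      pairTerm (δ G e) s +ℤ pairTerm (δ (τ (δ G e) e) e) s ∎)
  where
  open Coefficient e n
  open PairTerms G valid e n
  open ≡-Reasoning
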